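{- Let $G$ and $H$ be connected graphs, let $Q$ be a proper subset of $V(G)$, $\overline{Q} = V(G)\setminus Q$, and let $\emptyset \neq S_{\overline{Q}} \subseteq \bigcup_{w\in \overline{Q}} V(H_w)$. Then $S = Q \cup S_{\overline{Q}}$ is a mutual-visibility set of $G \odot H$ if and only if $W = \{ w \in \overline{Q} : S \cap V(H_w) \neq \emptyset\}$ is a non-empty absolute $c_Q$-visible set of $G$.
   Context: All graphs are finite, simple, undirected and connected. For a graph $G$ and $X \subseteq V(G)$, two vertices $u,v$ are $X$-visible if there exists a shortest $(u,v)$-path $P$ in $G$ with $V(P)\cap X \subseteq \{u,v\}$; a set $Y$ is $X$-visible if every two vertices of $Y$ are $X$-visible. A set $X\subseteq V(G)$ is a mutual-visibility set of $G$ if it is $X$-visible. For $Q\subseteq V(G)$, a set $W\subseteq \overline{Q}=V(G)\setminus Q$ is $c_Q$-visible (co-visible with respect to $Q$) if $W$ is $Q$-visible and $u,w$ are $Q$-visible for all $u\in Q$, $w\in W$. A $c_Q$-visible set $W$ is absolute if moreover $Q$ is a mutual-visibility set of $G$. The corona $G\odot H$ is obtained from one copy of $G$ and $|V(G)|$ copies of $H$, the copy associated with $v\in V(G)$ being denoted $H_v$, by joining each $v \in V(G)$ to every vertex of $H_v$. -}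

module Defs where

open import Level using (0ℓ)
open import Data.Nat using (ℕ; zero; suc; _≤_)
open import Data.Fin using (Fin)
open import Data.Fin.Properties using () renaming (_≟_ to _≟ᶠ_)
open import Data.Product using (Σ; ∃; _×_; _,_; proj₁; proj₂)
open import Data.Sum using (_⊎_; inj₁; inj₂)
open import Data.List using (List; []; _∷_)
open import Data.List.Membership.Propositional using () renaming (_∈_ to _∈ₗ_)
open import Relation.Nullary using (¬_; Dec; yes; no)
open import Relation.Nullary.Decidable using (_×-dec_)
open import Relation.Unary using (Pred)
open import Relation.Binary using (Decidable)
open import Relation.Binary.PropositionalEquality using (_≡_; refl; sym)

record Graph (V : Set) : Set₁ where
  field
    Adj        : V → V → Set
    adj-sym    : ∀ {u v} → Adj u v → Adj v u
    adj-irrefl : ∀ {u} → ¬ Adj u u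
    adj?       : Decidable Adj

module _ {V : Set} (G : Graph V) where
  open Graph G

  data Walk : V → V → Set where
    [] : ∀ {u} → Walk u u
    _∷_ : ∀ {u w v} → Adj u w → Walk w v → Walk u v

  len : ∀ {u v} → Walk u v → ℕ
  len [] = zero
  len (_ ∷ p) = suc (len p)

  verts : ∀ {u v} → Walk u v → List V
  verts {u} [] = u ∷ []
  verts {u} (_ ∷ p) = u ∷ verts p

  IsShortest : ∀ {u v} → Walk u v → Set
  IsShortest {u} {v} p = ∀ (q : Walk u v) → len p ≤ len q

  Connected : Set
  Connected = ∀ u v → Walk u v

  Visible : Pred V 0ℓ → V → V → Set
  Visible X u v = Σ (Walk u v) λ p → IsShortest p ×
    (∀ z → z ∈ₗ verts p → X z → (z ≡ u) ⊎ (z ≡ v))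

  VisibleSet : Pred V 0ℓ → Pred V 0ℓ → Set
  VisibleSet X Y = ∀ u v → Y u → Y v → Visible X u v

  IsMutualVisibilitySet : Pred V 0ℓ → Set
  IsMutualVisibilitySet X = VisibleSet X X

  IsCoVisible : Pred V 0ℓ → Pred V 0ℓ → Set
  IsCoVisible Q W = (∀ w → W w → ¬ Q w) × VisibleSet Q W ×
                    (∀ u w → Q u → W w → Visible Q u w)

  IsAbsoluteCoVisible : Pred V 0ℓ → Pred V 0ℓ → Set
  IsAbsoluteCoVisible Q W = IsCoVisible Q W × IsMutualVisibilitySet Q

-- Corona G ⊙ H for G on Fin n and H on Fin m.
-- Vertex inj₁ v is v ∈ V(G); vertex inj₂ (v , x) is the copy of x in H_v.

CoronaV : ℕ → ℕ → Set
CoronaV n m = Fin n ⊎ (Fin n × Fin m)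

module _ {n m : ℕ} (G : Graph (Fin n)) (H : Graph (Fin m)) where
  private
    module G = Graph G
    module H = Graph H

  CAdj : CoronaV n m → CoronaV n m → Set
  CAdj (inj₁ a) (inj₁ b) = G.Adj a b
  CAdj (inj₁ a) (inj₂ (b , y)) = a ≡ b
  CAdj (inj₂ (a , x)) (inj₁ b) = a ≡ b
  CAdj (inj₂ (a , x)) (inj₂ (b , y)) = (a ≡ b) × H.Adj x y

  private
    csym : ∀ {u v} → CAdj u v → CAdj v u
    csym {inj₁ a} {inj₁ b} e = G.adj-sym e
    csym {inj₁ a} {inj₂ _} e = sym e
    csym {inj₂ _} {inj₁ b} e = sym e
    csym {inj₂ _} {inj₂ _} (e , f) = sym e , H.adj-sym f

    cirr : ∀ {u} → ¬ CAdj u u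
    cirr {inj₁ a} e = G.adj-irrefl e
    cirr {inj₂ _} (_ , f) = H.adj-irrefl f

    cdec : Decidable CAdj
    cdec (inj₁ a) (inj₁ b) = G.adj? a b
    cdec (inj₁ a) (inj₂ (b , y)) = a ≟ᶠ b
    cdec (inj₂ (a , x)) (inj₁ b) = a ≟ᶠ b
    cdec (inj₂ (a , x)) (inj₂ (b , y)) = (a ≟ᶠ b) ×-dec H.adj? x y

  corona : Graph (CoronaV n m)
  corona = record { Adj = CAdj ; adj-sym = λ {u} {v} → csym {u} {v} ; adj-irrefl = λ {u} → cirr {u} ; adj? = cdec }

-- S = Q ∪ S_Q̄ on V(G ⊙ H), where S_Q̄ is given by its traces
-- T w = S_Q̄ ∩ V(H_w) ⊆ V(H).

open import Data.Fin.Subset using (Subset; _∈_)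

unionSet : ∀ {n m} → Subset n → (Fin n → Subset m) → Pred (CoronaV n m) 0ℓ
unionSet Q T (inj₁ v) = v ∈ Q
unionSet Q T (inj₂ (w , x)) = x ∈ T w

{-# OPTIONS --safe #-}
-- Away from a single copy H_w, a walk in G ⊙ H projects to a walk in G between the
-- bases, and every walk in G lifts back; the lift is longer by the number (0, 1 or 2)
-- of endpoints lying in copies of H, and any other walk is at least that much longer.
-- So shortest paths between such vertices are exactly lifts of shortest paths of G,
-- and the vertices of S on a lift are the Q-vertices of the G-path, the bases of
-- occupied copies not being in Q. Reading this for pairs in Q × Q, Q × W and W × W
-- gives both directions; two vertices of one copy H_w see each other directly or
-- through w ∉ Q.
module Submission where

open import Defs
open import Data.Nat using (ℕ; suc; _+_; _≤_; _<_; z≤n; s≤s)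
open import Data.Nat.Properties
  using (m≤n⇒m≤1+n; +-cancelˡ-≤; +-monoʳ-≤; +-suc; +-identityʳ; module ≤-Reasoning)
open import Data.Fin using (Fin)
open import Data.Fin.Properties using () renaming (_≟_ to _≟ᶠ_)
open import Data.Fin.Subset using (Subset; _∈_; _∉_)
open import Data.Product using (∃; _×_; _,_; proj₁)
open import Data.Sum as Sum using (_⊎_; inj₁; inj₂)
open import Data.List using (_∷_; map)
open import Data.List.Membership.Propositional using () renaming (_∈_ to _∈ₗ_)
open import Data.List.Membership.Propositional.Properties using (∈-map⁻)
open import Data.List.Relation.Binary.Subset.Propositional using (_⊆_)
open import Data.List.Relation.Unary.Any using (here; there)
open import Data.Empty using (⊥-elim)
open import Function.Bundles using (_⇔_; mk⇔)
open import Level using (0ℓ)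
open import Relation.Binary.PropositionalEquality using (_≡_; _≢_; refl; cong; trans; subst)
open import Relation.Nullary using (¬_; yes; no)
open import Relation.Unary using (Pred)

module _ {V : Set} {G : Graph V} where
  open Graph G

  private variable
    u v w : V

  head∈verts : (p : Walk G u v) → u ∈ₗ verts G p
  head∈verts []      = here refl
  head∈verts (_ ∷ _) = here refl

  reverseAcc : Walk G u v → Walk G u w → Walk G v w
  reverseAcc []      acc = acc
  reverseAcc (e ∷ p) acc = reverseAcc p (adj-sym e ∷ acc)

  reverse : Walk G u v → Walk G v u
  reverse p = reverseAcc p []

  len-reverseAcc : (p : Walk G u v) (acc : Walk G u w) →
                   len G (reverseAcc p acc) ≡ len G p + len G acc
  len-reverseAcc []      acc = refl
  len-reverseAcc (e ∷ p) acc = trans (len-reverseAcc p _) (+-suc (len G p) (len G acc))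

  len-reverse : (p : Walk G u v) → len G (reverse p) ≡ len G p
  len-reverse p = trans (len-reverseAcc p []) (+-identityʳ (len G p))

  verts-reverseAcc : ∀ {z} (p : Walk G u v) (acc : Walk G u w) →
                     z ∈ₗ verts G (reverseAcc p acc) → z ∈ₗ verts G p ⊎ z ∈ₗ verts G acc
  verts-reverseAcc []      acc k = inj₂ k
  verts-reverseAcc (e ∷ p) acc k with verts-reverseAcc p (adj-sym e ∷ acc) k
  ... | inj₁ k′          = inj₁ (there k′)
  ... | inj₂ (here refl) = inj₁ (there (head∈verts p))
  ... | inj₂ (there k′)  = inj₂ k′

  verts-reverse : (p : Walk G u v) → verts G (reverse p) ⊆ verts G p
  verts-reverse p k with verts-reverseAcc p [] k
  ... | inj₁ k′         = k′
  ... | inj₂ (here refl) = head∈verts p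

  Adj⇒0<len : Adj u v → (p : Walk G u v) → 0 < len G p
  Adj⇒0<len u~u []      = ⊥-elim (adj-irrefl u~u)
  Adj⇒0<len _   (_ ∷ _) = s≤s z≤n

module _ {V : Set} (G : Graph V) (X : Pred V 0ℓ) where
  open Graph G
  open ≤-Reasoning

  private variable
    u v : V

  Visible-refl : Visible G X u u
  Visible-refl = [] , (λ _ → z≤n) , λ { _ (here z≡u) _ → inj₁ z≡u }

  Visible-adjacent : Adj u v → Visible G X u v
  Visible-adjacent {u} {v} u~v = (u~v ∷ []) , Adj⇒0<len u~v , clear
    where
    clear : ∀ z → z ∈ₗ verts G (u~v ∷ []) → X z → z ≡ u ⊎ z ≡ v
    clear _ (here z≡u)         _ = inj₁ z≡u
    clear _ (there (here z≡v)) _ = inj₂ z≡v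

  Visible-sym : Visible G X u v → Visible G X v u
  Visible-sym {u} {v} (p , p-shortest , p-clear) = reverse p , shortest , clear
    where
    shortest : IsShortest G (reverse p)
    shortest q = begin
      len G (reverse p) ≡⟨ len-reverse p ⟩
      len G p           ≤⟨ p-shortest (reverse q) ⟩
      len G (reverse q) ≡⟨ len-reverse q ⟩
      len G q           ∎
    clear : ∀ z → z ∈ₗ verts G (reverse p) → X z → z ≡ v ⊎ z ≡ u
    clear z k z∈X = Sum.swap (p-clear z (verts-reverse p k) z∈X)

module _ {n m : ℕ} (G : Graph (Fin n)) (H : Graph (Fin m)) where
  private
    module H = Graph H
    C = corona G H

  private variable
    u v w : Fin n
    x y : Fin m
    a b : CoronaV n m

  base : CoronaV n m → Fin n
  base (inj₁ v)       = v
  base (inj₂ (v , _)) = v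

  project : Walk C a b → Walk G (base a) (base b)
  project [] = []
  project {inj₁ _} (_∷_ {w = inj₁ _} u~v        p) = u~v ∷ project p
  project {inj₁ _} (_∷_ {w = inj₂ _} refl       p) = project p
  project {inj₂ _} (_∷_ {w = inj₁ _} refl       p) = project p
  project {inj₂ _} (_∷_ {w = inj₂ _} (refl , _) p) = project p

  len-project≤len : (p : Walk C a b) → len G (project p) ≤ len C p
  len-project≤len [] = z≤n
  len-project≤len {inj₁ _} (_∷_ {w = inj₁ _} _ p)          = s≤s (len-project≤len p)
  len-project≤len {inj₁ _} (_∷_ {w = inj₂ _} refl p)       = m≤n⇒m≤1+n (len-project≤len p)
  len-project≤len {inj₂ _} (_∷_ {w = inj₁ _} refl p)       = m≤n⇒m≤1+n (len-project≤len p)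
  len-project≤len {inj₂ _} (_∷_ {w = inj₂ _} (refl , _) p) = m≤n⇒m≤1+n (len-project≤len p)

  1+len-project≤len : (p : Walk C (inj₁ u) (inj₂ (v , y))) → 1 + len G (project p) ≤ len C p
  1+len-project≤len (_∷_ {w = inj₁ _} _ p)    = s≤s (1+len-project≤len p)
  1+len-project≤len (_∷_ {w = inj₂ _} refl p) = s≤s (len-project≤len p)

  2+len-project≤len : u ≢ v → (p : Walk C (inj₂ (u , x)) (inj₂ (v , y))) →
                      2 + len G (project p) ≤ len C p
  2+len-project≤len u≢u [] = ⊥-elim (u≢u refl)
  2+len-project≤len _   (_∷_ {w = inj₁ _} refl p)       = s≤s (1+len-project≤len p)
  2+len-project≤len u≢v (_∷_ {w = inj₂ _} (refl , _) p) = m≤n⇒m≤1+n (2+len-project≤len u≢v p)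

  ∈-verts-project⁻ : ∀ {z} (p : Walk C a b) → z ∈ₗ verts G (project p) →
                     z ≡ base a ⊎ inj₁ z ∈ₗ verts C p
  ∈-verts-project⁻ [] (here z≡a) = inj₁ z≡a
  ∈-verts-project⁻ {inj₁ _} (_∷_ {w = inj₁ _} _ p) (here z≡a) = inj₁ z≡a
  ∈-verts-project⁻ {inj₁ _} (_∷_ {w = inj₁ _} _ p) (there k) with ∈-verts-project⁻ p k
  ... | inj₁ refl = inj₂ (there (head∈verts p))
  ... | inj₂ k′   = inj₂ (there k′)
  ∈-verts-project⁻ {inj₁ _} (_∷_ {w = inj₂ _} refl p)       k = Sum.map₂ there (∈-verts-project⁻ p k)
  ∈-verts-project⁻ {inj₂ _} (_∷_ {w = inj₁ _} refl p)       k = Sum.map₂ there (∈-verts-project⁻ p k)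
  ∈-verts-project⁻ {inj₂ _} (_∷_ {w = inj₂ _} (refl , _) p) k = Sum.map₂ there (∈-verts-project⁻ p k)

  liftᴳ : Walk G u v → Walk C (inj₁ u) (inj₁ v)
  liftᴳ []        = []
  liftᴳ (u~v ∷ p) = u~v ∷ liftᴳ p

  liftᴴ : Walk G u v → Walk C (inj₁ u) (inj₂ (v , y))
  liftᴴ []        = refl ∷ []
  liftᴴ (u~v ∷ p) = u~v ∷ liftᴴ p

  len-liftᴳ : (p : Walk G u v) → len C (liftᴳ p) ≡ len G p
  len-liftᴳ []      = refl
  len-liftᴳ (_ ∷ p) = cong suc (len-liftᴳ p)

  len-liftᴴ : (p : Walk G u v) → len C (liftᴴ {y = y} p) ≡ 1 + len G p
  len-liftᴴ []      = refl
  len-liftᴴ (_ ∷ p) = cong suc (len-liftᴴ p)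

  verts-liftᴳ : (p : Walk G u v) → verts C (liftᴳ p) ≡ map inj₁ (verts G p)
  verts-liftᴳ []      = refl
  verts-liftᴳ (_ ∷ p) = cong (inj₁ _ ∷_) (verts-liftᴳ p)

  verts-liftᴴ : (p : Walk G u v) → verts C (liftᴴ {y = y} p) ⊆ inj₂ (v , y) ∷ map inj₁ (verts G p)
  verts-liftᴴ []      (here z≡u)         = there (here z≡u)
  verts-liftᴴ []      (there (here z≡b)) = here z≡b
  verts-liftᴴ (_ ∷ p) (here z≡u)         = there (here z≡u)
  verts-liftᴴ (_ ∷ p) (there k) with verts-liftᴴ p k
  ... | here z≡b = here z≡b
  ... | there k′ = there (there k′)

  -- Consequently d(a, b) = c + d_G(base a, base b) in G ⊙ H.
  record Lifting (c : ℕ) (a b : CoronaV n m) : Set where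
    field
      lift        : Walk G (base a) (base b) → Walk C a b
      len-lift    : ∀ p → len C (lift p) ≡ c + len G p
      len-project : (q : Walk C a b) → c + len G (project q) ≤ len C q
      verts-lift  : ∀ p → verts C (lift p) ⊆ a ∷ (b ∷ map inj₁ (verts G p))

  liftingᴳᴳ : ∀ u v → Lifting 0 (inj₁ u) (inj₁ v)
  liftingᴳᴳ u v = record
    { lift        = liftᴳ
    ; len-lift    = len-liftᴳ
    ; len-project = len-project≤len
    ; verts-lift  = λ p k → there (there (subst (_ ∈ₗ_) (verts-liftᴳ p) k))
    }

  liftingᴳᴴ : ∀ u v y → Lifting 1 (inj₁ u) (inj₂ (v , y))
  liftingᴳᴴ u v y = record
    { lift        = liftᴴ
    ; len-lift    = len-liftᴴ
    ; len-project = 1+len-project≤len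
    ; verts-lift  = λ p k → there (verts-liftᴴ p k)
    }

  liftingᴴᴴ : u ≢ v → Lifting 2 (inj₂ (u , x)) (inj₂ (v , y))
  liftingᴴᴴ u≢v = record
    { lift        = λ p → refl ∷ liftᴴ p
    ; len-lift    = λ p → cong suc (len-liftᴴ p)
    ; len-project = 2+len-project≤len u≢v
    ; verts-lift  = λ { p (here z≡a) → here z≡a ; p (there k) → there (verts-liftᴴ p k) }
    }

  2≤len-within-fibre : x ≢ y → ¬ H.Adj x y →
                       (q : Walk C (inj₂ (w , x)) (inj₂ (w , y))) → 2 ≤ len C q
  2≤len-within-fibre x≢x _ [] = ⊥-elim (x≢x refl)
  2≤len-within-fibre _ _   (_∷_ {w = inj₁ _} _ (_ ∷ _))     = s≤s (s≤s z≤n)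
  2≤len-within-fibre _ _   (_∷_ {w = inj₂ _} _ (_ ∷ _))     = s≤s (s≤s z≤n)
  2≤len-within-fibre _ x≁y (_∷_ {w = inj₂ _} (_ , x~y) []) = ⊥-elim (x≁y x~y)

  module _ (Q : Subset n) (T : Fin n → Subset m) where
    open ≤-Reasoning

    private
      S : Pred (CoronaV n m) 0ℓ
      S = unionSet Q T

    occupied : Pred (Fin n) 0ℓ
    occupied w = w ∉ Q × ∃ (λ x → x ∈ T w)

    project-Visible : ∀ {c} → Lifting c a b →
                      Visible C S a b → Visible G (_∈ Q) (base a) (base b)
    project-Visible {a} {b} {c} L (q , q-shortest , q-clear) = project q , shortest , clear
      where
      open Lifting L
      shortest : IsShortest G (project q)
      shortest p = +-cancelˡ-≤ c _ _ (begin
        c + len G (project q) ≤⟨ len-project q ⟩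
        len C q               ≤⟨ q-shortest (lift p) ⟩
        len C (lift p)        ≡⟨ len-lift p ⟩
        c + len G p           ∎)
      clear : ∀ z → z ∈ₗ verts G (project q) → z ∈ Q → z ≡ base a ⊎ z ≡ base b
      clear z k z∈Q with ∈-verts-project⁻ q k
      ... | inj₁ z≡a = inj₁ z≡a
      ... | inj₂ k′  = Sum.map (cong base) (cong base) (q-clear (inj₁ z) k′ z∈Q)

    Visible-within-fibre : w ∉ Q → ∀ x y → Visible C S (inj₂ (w , x)) (inj₂ (w , y))
    Visible-within-fibre {w} w∉Q x y with x ≟ᶠ y | H.adj? x y
    ... | yes refl | _       = Visible-refl C S
    ... | no _     | yes x~y = Visible-adjacent C S (refl , x~y)
    ... | no x≢y   | no x≁y  = (refl ∷ liftᴴ []) , 2≤len-within-fibre x≢y x≁y , clear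
      where
      clear : ∀ z → z ∈ₗ verts C (refl ∷ liftᴴ {u = w} {y = y} []) → S z →
              z ≡ inj₂ (w , x) ⊎ z ≡ inj₂ (w , y)
      clear _ (here z≡a)                 _   = inj₁ z≡a
      clear _ (there (here refl))        w∈Q = ⊥-elim (w∉Q w∈Q)
      clear _ (there (there (here z≡b))) _   = inj₂ z≡b

    mutual⇒absoluteCoVisible : IsMutualVisibilitySet C S → IsAbsoluteCoVisible G (_∈ Q) occupied
    mutual⇒absoluteCoVisible S-mutual =
      ((λ _ → proj₁) , occupied-visible , Q-occupied-visible) , Q-mutual
      where
      Q-mutual : IsMutualVisibilitySet G (_∈ Q)
      Q-mutual u v u∈Q v∈Q = project-Visible (liftingᴳᴳ u v) (S-mutual _ _ u∈Q v∈Q)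
      Q-occupied-visible : ∀ u w → u ∈ Q → occupied w → Visible G (_∈ Q) u w
      Q-occupied-visible u w u∈Q (_ , y , y∈T) =
        project-Visible (liftingᴳᴴ u w y) (S-mutual _ _ u∈Q y∈T)
      occupied-visible : VisibleSet G (_∈ Q) occupied
      occupied-visible u v (_ , x , x∈T) (_ , y , y∈T) with u ≟ᶠ v
      ... | yes refl = Visible-refl G (_∈ Q)
      ... | no u≢v   = project-Visible (liftingᴴᴴ u≢v) (S-mutual _ _ x∈T y∈T)

    module _ (T⊆Q̄ : ∀ w x → x ∈ T w → w ∉ Q) where

      base∈S⇒base≡ : S a → S (inj₁ (base a)) → inj₁ (base a) ≡ a
      base∈S⇒base≡ {inj₁ _}       _   _   = refl
      base∈S⇒base≡ {inj₂ (w , x)} x∈T w∈Q = ⊥-elim (T⊆Q̄ w x x∈T w∈Q)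

      lift-Visible : ∀ {c} → Lifting c a b → S a → S b →
                     Visible G (_∈ Q) (base a) (base b) → Visible C S a b
      lift-Visible {a} {b} {c} L a∈S b∈S (p , p-shortest , p-clear) = lift p , shortest , clear
        where
        open Lifting L
        shortest : IsShortest C (lift p)
        shortest q = begin
          len C (lift p)        ≡⟨ len-lift p ⟩
          c + len G p           ≤⟨ +-monoʳ-≤ c (p-shortest (project q)) ⟩
          c + len G (project q) ≤⟨ len-project q ⟩
          len C q               ∎
        clear : ∀ z → z ∈ₗ verts C (lift p) → S z → z ≡ a ⊎ z ≡ b
        clear z k z∈S with verts-lift p k
        ... | here z≡a         = inj₁ z≡a
        ... | there (here z≡b) = inj₂ z≡b
        ... | there (there k′) with ∈-map⁻ inj₁ k′
        ...   | z′ , k″ , refl with p-clear z′ k″ z∈S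
        ...     | inj₁ refl = inj₁ (base∈S⇒base≡ a∈S z∈S)
        ...     | inj₂ refl = inj₂ (base∈S⇒base≡ b∈S z∈S)

      absoluteCoVisible⇒mutual : IsAbsoluteCoVisible G (_∈ Q) occupied → IsMutualVisibilitySet C S
      absoluteCoVisible⇒mutual ((_ , occupied-visible , Q-occupied-visible) , Q-mutual) = S-mutual
        where
        Q-to-fibre : u ∈ Q → y ∈ T v → Visible C S (inj₁ u) (inj₂ (v , y))
        Q-to-fibre {u} {y} {v} u∈Q y∈T = lift-Visible (liftingᴳᴴ u v y) u∈Q y∈T
          (Q-occupied-visible u v u∈Q (T⊆Q̄ v y y∈T , y , y∈T))
        S-mutual : IsMutualVisibilitySet C S
        S-mutual (inj₁ u) (inj₁ v) u∈Q v∈Q =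
          lift-Visible (liftingᴳᴳ u v) u∈Q v∈Q (Q-mutual u v u∈Q v∈Q)
        S-mutual (inj₁ _) (inj₂ _) u∈Q y∈T = Q-to-fibre u∈Q y∈T
        S-mutual (inj₂ _) (inj₁ _) y∈T u∈Q = Visible-sym C S (Q-to-fibre u∈Q y∈T)
        S-mutual (inj₂ (u , x)) (inj₂ (v , y)) x∈T y∈T with u ≟ᶠ v
        ... | yes refl = Visible-within-fibre (T⊆Q̄ u x x∈T) x y
        ... | no u≢v   = lift-Visible (liftingᴴᴴ u≢v) x∈T y∈T
          (occupied-visible u v (T⊆Q̄ u x x∈T , x , x∈T) (T⊆Q̄ v y y∈T , y , y∈T))

mainTheorem11 : ∀ {n m : ℕ} (G : Graph (Fin n)) (H : Graph (Fin m)) →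
    Connected G → Connected H →
    (Q : Subset n) → ∃ (λ v → v ∉ Q) →
    (T : Fin n → Subset m) →
    (∀ w x → x ∈ T w → w ∉ Q) →
    ∃ (λ w → ∃ (λ x → x ∈ T w)) →
    IsMutualVisibilitySet (corona G H)
      (unionSet Q T)
    ⇔
    (∃ (λ w → w ∉ Q × ∃ (λ x → x ∈ T w)) ×
     IsAbsoluteCoVisible G (λ v → v ∈ Q) (λ w → w ∉ Q × ∃ (λ x → x ∈ T w)))
mainTheorem11 G H _ _ Q _ T T⊆Q̄ (w , x , x∈T) = mk⇔
  (λ S-mutual → (w , T⊆Q̄ w x x∈T , x , x∈T) , mutual⇒absoluteCoVisible G H Q T S-mutual)
  (λ (_ , absolute) → absoluteCoVisible⇒mutual G H Q T T⊆Q̄ absolute)
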